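{- Let $A(1,q,1)=\sum_D q^{\mathrm{sump}(D)}$, summed over all non-empty Dyck paths $D$. Equivalently, $A(1,q,1)=\sum_P q^{\mathrm{area}(P)-\mathrm{row}(P)}$ summed over Stanley polyominoes $P$ with at least two columns. Then \[ A(1,q,1)=-1+\cfrac{1}{2-q-\cfrac{1}{2-q^2-\cfrac{1}{2-q^3-\cfrac{1}{2-q^4-\cdots}}}}. \]
   Context: Dyck paths are lattice paths from $(0,0)$ to $(2n,0)$ with steps $u=(1,1)$, $d=(1,-1)$ never going below the $x$-axis; a peak is an occurrence of $ud$, its height being the ordinate of its top point, and $\mathrm{sump}(D)$ is the sum of peak heights. A Stanley polyomino (up to translation) is a set of unit cells $[i,i+1]\times[j,j+1]$ forming rows $0,\dots,k-1$, row $j$ consisting of cells with $s_j\le i\le e_j$, such that $s_{j-1}<s_j\le e_{j-1}<e_j$; $\mathrm{row}(P)=k$, its number of columns is $e_{k-1}-s_0+1$, and $\mathrm{area}(P)$ is its number of cells. -}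

module Defs where

open import Data.Nat using (ℕ; zero; suc; _+_; pred)
open import Data.Integer using (ℤ; +_; -_) renaming (_+_ to _+ℤ_; _*_ to _*ℤ_; _-_ to _-ℤ_)
open import Data.List using (List; []; _∷_; zipWith; map; foldr; upTo)
open import Data.Bool using (if_then_else_)
open import Data.Nat using (_≡ᵇ_)

data Step : Set where
  U D : Step

data DyckFrom : ℕ → List Step → Set where
  done : DyckFrom 0 []
  up   : ∀ {h s} → DyckFrom (suc h) s → DyckFrom h (U ∷ s)
  down : ∀ {h s} → DyckFrom h s → DyckFrom (suc h) (D ∷ s)

Dyck : List Step → Set
Dyck s = DyckFrom 0 s

-- sum of the heights of the peaks (occurrences of U D), starting at height h
sumpFrom : ℕ → List Step → ℕ
sumpFrom h []            = 0
sumpFrom h (U ∷ [])      = 0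
sumpFrom h (U ∷ U ∷ s)   = sumpFrom (suc h) (U ∷ s)
sumpFrom h (U ∷ D ∷ s)   = suc h + sumpFrom (suc h) (D ∷ s)
sumpFrom h (D ∷ s)       = sumpFrom (pred h) s

sump : List Step → ℕ
sump = sumpFrom 0

Series : Set
Series = ℕ → ℤ

const : ℤ → Series
const c zero    = c
const c (suc _) = + 0

qpow : ℕ → Series
qpow m n = if m ≡ᵇ n then + 1 else + 0

_⊕_ : Series → Series → Series
(a ⊕ b) n = a n +ℤ b n

_⊖_ : Series → Series → Series
(a ⊖ b) n = a n -ℤ b n

-- Reversed list [b n, b (n-1), …, b 0] of coefficients of the inverse 1/a,
-- for a series a with constant term 1 (the only case used below):
-- b 0 = 1,  b n = - Σ_{i=1}^{n} a i * b (n - i).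
invRev : Series → ℕ → List ℤ
invRev a zero    = + 1 ∷ []
invRev a (suc n) =
  (- foldr _+ℤ_ (+ 0) (zipWith _*ℤ_ (map (λ i → a (suc i)) (upTo (suc n))) bs)) ∷ bs
  where bs = invRev a n

headℤ : List ℤ → ℤ
headℤ []      = + 0
headℤ (x ∷ _) = x

inv : Series → Series
inv a n = headℤ (invRev a n)

-- Depth-d truncation of the continued fraction
--   C_m = 1 / (2 - q^m - C_{m+1}),
-- with the innermost tail C_{m+d} replaced by 1.
cf : ℕ → ℕ → Series
cf zero    m = const (+ 1)
cf (suc d) m = inv ((const (+ 2) ⊖ qpow m) ⊖ cf d (suc m))

Acf : ℕ → Series
Acf N = const (- (+ 1)) ⊕ cf N 1

-- A non-empty Dyck path factors by its first return as U P D Q, so paths are binary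
-- trees. Let C_m count the paths whose base lies at height m - 1 by the sum of their
-- peak heights. The factor P contributes q^m when it is empty and C_{m+1} - 1
-- otherwise, whence C_m = 1 + (q^m + C_{m+1} - 1) C_m, i.e.
-- C_m = 1 / (2 - q^m - C_{m+1}). Cutting the continued fraction at depth d counts the
-- paths of height at most d, and a path with sump k has height at most k, so from
-- depth k on the coefficient of q^k in C_1 - 1 is the number of such paths.
module Submission where

open import Defs
open import Data.Nat using (ℕ; _≤_)
open import Data.Integer using (+_)
open import Data.List using (List; []; length)
open import Data.List.Membership.Propositional using (_∈_)
open import Data.List.Relation.Unary.Unique.Propositional using (Unique)
open import Data.Product using (_×_; ∃-syntax)
open import Function.Bundles using (_⇔_)
open import Relation.Binary.PropositionalEquality using (_≡_; _≢_)

open import Data.Bool using (Bool; true; false; T)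
open import Data.Empty using (⊥)
open import Data.Integer as ℤ using (ℤ; -_)
import Data.Integer.Properties as ℤ
open import Data.List
  using (_∷_; _++_; map; foldr; zipWith; applyUpTo; applyDownFrom; cartesianProductWith)
open import Data.List.Membership.Propositional.Properties
  using (∈-++⁺ˡ; ∈-++⁺ʳ; ∈-++⁻; ∈-map⁺; ∈-map⁻; ∈-cartesianProductWith⁺; ∈-cartesianProductWith⁻)
open import Data.List.Membership.Propositional.Properties.WithK using (unique∧set⇒bag)
open import Data.List.Properties
  using (length-++; length-map; map-upTo; ++-assoc; ++-identityʳ; ∷-injectiveʳ)
open import Data.List.Relation.Binary.BagAndSetEquality using (∼bag⇒↭)
open import Data.List.Relation.Binary.Permutation.Propositional.Properties using (↭-length)
open import Data.List.Relation.Unary.All using ([])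
open import Data.List.Relation.Unary.AllPairs using ([]; _∷_)
open import Data.List.Relation.Unary.Any using (here)
import Data.List.Relation.Unary.Unique.Propositional.Properties as Unique
open import Data.Nat using (zero; suc; _+_; _*_; _<_; _≡ᵇ_; z≤n; s≤s)
open import Data.Nat.Properties
open import Data.Product using (_,_; proj₁; proj₂)
open import Data.Sum using (inj₁; inj₂)
open import Function using (_∘_)
open import Function.Bundles using (mk⇔; module Equivalence)
import Function.Properties.Equivalence as ⇔
open import Relation.Binary.PropositionalEquality
  using (refl; sym; trans; cong; cong₂; subst; module ≡-Reasoning)
open import Relation.Nullary using (contradiction)

open ≡-Reasoning

_⋆_ : (ℕ → ℕ) → (ℕ → ℕ) → ℕ → ℕ
(F ⋆ G) zero    = F 0 * G 0
(F ⋆ G) (suc n) = F 0 * G (suc n) + ((F ∘ suc) ⋆ G) n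

-x*y+-z≡-[x*y+z] : ∀ x y z → - (+ x) ℤ.* + y ℤ.+ - (+ z) ≡ - (+ (x * y + z))
-x*y+-z≡-[x*y+z] x y z = begin
  - (+ x) ℤ.* + y ℤ.+ - (+ z)  ≡⟨ cong (ℤ._+ - (+ z)) (sym (ℤ.neg-distribˡ-* (+ x) (+ y))) ⟩
  - (+ x ℤ.* + y) ℤ.+ - (+ z)  ≡⟨ sym (ℤ.neg-distrib-+ (+ x ℤ.* + y) (+ z)) ⟩
  - (+ x ℤ.* + y ℤ.+ + z)      ≡⟨ cong (λ w → - (w ℤ.+ + z)) (sym (ℤ.pos-* x y)) ⟩
  - (+ (x * y) ℤ.+ + z)        ≡⟨ cong -_ (sym (ℤ.pos-+ (x * y) z)) ⟩
  - (+ (x * y + z))            ∎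

sum-zipWith-neg : ∀ n {a b : ℕ → ℤ} {F G : ℕ → ℕ} →
  (∀ {i} → i ≤ n → a i ≡ - (+ F i)) → (∀ {j} → j ≤ n → b j ≡ + G j) →
  foldr ℤ._+_ (+ 0) (zipWith ℤ._*_ (applyUpTo a (suc n)) (applyDownFrom b (suc n)))
    ≡ - (+ (F ⋆ G) n)
sum-zipWith-neg zero {a} {b} {F} {G} aF bG = begin
  a 0 ℤ.* b 0 ℤ.+ + 0                ≡⟨ cong₂ (λ x y → x ℤ.* y ℤ.+ + 0) (aF z≤n) (bG z≤n) ⟩
  - (+ F 0) ℤ.* + G 0 ℤ.+ - (+ 0)    ≡⟨ -x*y+-z≡-[x*y+z] (F 0) (G 0) 0 ⟩
  - (+ (F 0 * G 0 + 0))              ≡⟨ cong (-_ ∘ +_) (+-identityʳ (F 0 * G 0)) ⟩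
  - (+ (F 0 * G 0))                  ∎
sum-zipWith-neg (suc n) {a} {b} {F} {G} aF bG = begin
  a 0 ℤ.* b (suc n) ℤ.+ foldr ℤ._+_ (+ 0) (zipWith ℤ._*_ (applyUpTo (a ∘ suc) (suc n)) (applyDownFrom b (suc n)))
      ≡⟨ cong₂ ℤ._+_ (cong₂ ℤ._*_ (aF z≤n) (bG ≤-refl))
                     (sum-zipWith-neg n (aF ∘ s≤s) (bG ∘ m≤n⇒m≤1+n)) ⟩
  - (+ F 0) ℤ.* + G (suc n) ℤ.+ - (+ ((F ∘ suc) ⋆ G) n)
      ≡⟨ -x*y+-z≡-[x*y+z] (F 0) (G (suc n)) _ ⟩
  - (+ (F ⋆ G) (suc n)) ∎

invRev≡applyDownFrom-inv : ∀ a n → invRev a n ≡ applyDownFrom (inv a) (suc n)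
invRev≡applyDownFrom-inv a zero    = refl
invRev≡applyDownFrom-inv a (suc n) = cong (inv a (suc n) ∷_) (invRev≡applyDownFrom-inv a n)

inv-suc : ∀ {a n F G} →
  (∀ {i} → i ≤ n → a (suc i) ≡ - (+ F i)) → (∀ {j} → j ≤ n → inv a j ≡ + G j) →
  inv a (suc n) ≡ + (F ⋆ G) n
inv-suc {a} {n} {F} {G} aF invG = begin
  inv a (suc n)
    ≡⟨ cong₂ (λ xs ys → - foldr ℤ._+_ (+ 0) (zipWith ℤ._*_ xs ys))
             (map-upTo (a ∘ suc) (suc n)) (invRev≡applyDownFrom-inv a n) ⟩
  - foldr ℤ._+_ (+ 0) (zipWith ℤ._*_ (applyUpTo (a ∘ suc) (suc n)) (applyDownFrom (inv a) (suc n)))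
    ≡⟨ cong -_ (sum-zipWith-neg n aF invG) ⟩
  - - (+ (F ⋆ G) n)
    ≡⟨ ℤ.neg-involutive _ ⟩
  + (F ⋆ G) n ∎

module _ {A B C : Set} (f : A → B → C) where

  convolveWith : (ℕ → List A) → (ℕ → List B) → ℕ → List C
  convolveWith X Y zero    = cartesianProductWith f (X 0) (Y 0)
  convolveWith X Y (suc n) = cartesianProductWith f (X 0) (Y (suc n)) ++ convolveWith (X ∘ suc) Y n

  length-cartesianProductWith : ∀ xs ys →
    length (cartesianProductWith f xs ys) ≡ length xs * length ys
  length-cartesianProductWith []       ys = refl
  length-cartesianProductWith (x ∷ xs) ys = begin
    length (map (f x) ys ++ cartesianProductWith f xs ys)
      ≡⟨ length-++ (map (f x) ys) ⟩
    length (map (f x) ys) + length (cartesianProductWith f xs ys)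
      ≡⟨ cong₂ _+_ (length-map (f x) ys) (length-cartesianProductWith xs ys) ⟩
    length ys + length xs * length ys ∎

  length-convolveWith : ∀ X Y n →
    length (convolveWith X Y n) ≡ ((length ∘ X) ⋆ (length ∘ Y)) n
  length-convolveWith X Y zero    = length-cartesianProductWith (X 0) (Y 0)
  length-convolveWith X Y (suc n) = begin
    length (cartesianProductWith f (X 0) (Y (suc n)) ++ convolveWith (X ∘ suc) Y n)
      ≡⟨ length-++ (cartesianProductWith f (X 0) (Y (suc n))) ⟩
    length (cartesianProductWith f (X 0) (Y (suc n))) + length (convolveWith (X ∘ suc) Y n)
      ≡⟨ cong₂ _+_ (length-cartesianProductWith (X 0) (Y (suc n))) (length-convolveWith (X ∘ suc) Y n) ⟩
    ((length ∘ X) ⋆ (length ∘ Y)) (suc n) ∎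

  ∈-convolveWith⁺ : ∀ X Y i j {x y} → x ∈ X i → y ∈ Y j → f x y ∈ convolveWith X Y (i + j)
  ∈-convolveWith⁺ X Y zero    zero    x∈ y∈ = ∈-cartesianProductWith⁺ f x∈ y∈
  ∈-convolveWith⁺ X Y zero    (suc j) x∈ y∈ = ∈-++⁺ˡ (∈-cartesianProductWith⁺ f x∈ y∈)
  ∈-convolveWith⁺ X Y (suc i) j       x∈ y∈ =
    ∈-++⁺ʳ (cartesianProductWith f (X 0) (Y (suc (i + j)))) (∈-convolveWith⁺ (X ∘ suc) Y i j x∈ y∈)

  ∈-convolveWith⁻ : ∀ X Y n {z} → z ∈ convolveWith X Y n →
    ∃[ i ] ∃[ j ] i + j ≡ n × ∃[ x ] ∃[ y ] x ∈ X i × y ∈ Y j × z ≡ f x y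
  ∈-convolveWith⁻ X Y zero z∈
    with x , y , x∈ , y∈ , refl ← ∈-cartesianProductWith⁻ f (X 0) (Y 0) z∈
    = 0 , 0 , refl , x , y , x∈ , y∈ , refl
  ∈-convolveWith⁻ X Y (suc n) z∈ with ∈-++⁻ (cartesianProductWith f (X 0) (Y (suc n))) z∈
  ... | inj₁ z∈head with x , y , x∈ , y∈ , refl ← ∈-cartesianProductWith⁻ f (X 0) (Y (suc n)) z∈head
    = 0 , suc n , refl , x , y , x∈ , y∈ , refl
  ... | inj₂ z∈tail with i , j , i+j≡n , rest ← ∈-convolveWith⁻ (X ∘ suc) Y n z∈tail
    = suc i , j , cong suc i+j≡n , rest

  unique-convolveWith : (∀ {w x y z} → f w y ≡ f x z → w ≡ x × y ≡ z) →
    ∀ X Y n → (∀ i → Unique (X i)) → (∀ j → Unique (Y j)) →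
    (∀ {i i' x} → x ∈ X i → x ∈ X i' → i ≡ i') → Unique (convolveWith X Y n)
  unique-convolveWith f-inj X Y zero    uX uY disj = Unique.cartesianProductWith⁺ f f-inj (uX 0) (uY 0)
  unique-convolveWith f-inj X Y (suc n) uX uY disj =
    Unique.++⁺ (Unique.cartesianProductWith⁺ f f-inj (uX 0) (uY (suc n)))
               (unique-convolveWith f-inj (X ∘ suc) Y n (uX ∘ suc) uY
                                    (λ x∈ x∈' → suc-injective (disj x∈ x∈')))
               head-disjoint-tail
    where
    head-disjoint-tail : ∀ {z} → z ∈ cartesianProductWith f (X 0) (Y (suc n)) × z ∈ convolveWith (X ∘ suc) Y n → ⊥
    head-disjoint-tail (z∈head , z∈tail)
      with x , y , x∈ , y∈ , refl ← ∈-cartesianProductWith⁻ f (X 0) (Y (suc n)) z∈head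
      with i , j , _ , x' , y' , x'∈ , _ , eq ← ∈-convolveWith⁻ (X ∘ suc) Y n z∈tail
      with refl , _ ← f-inj eq
      = 0≢1+n (disj x∈ x'∈)

data Tree : Set where
  leaf : Tree
  node : Tree → Tree → Tree

node-injective : ∀ {l l' r r'} → node l r ≡ node l' r' → l ≡ l' × r ≡ r'
node-injective refl = refl , refl

encode : Tree → List Step
encode leaf       = []
encode (node l r) = U ∷ encode l ++ D ∷ encode r

encode-dyckFrom : ∀ t {h s} → DyckFrom h s → DyckFrom h (encode t ++ s)
encode-dyckFrom leaf       p = p
encode-dyckFrom (node l r) {s = s} p rewrite ++-assoc (encode l) (D ∷ encode r) s =
  up (encode-dyckFrom l (down (encode-dyckFrom r p)))

encode-dyck : ∀ t → Dyck (encode t)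
encode-dyck t = subst Dyck (++-identityʳ (encode t)) (encode-dyckFrom t done)

encode-prefix-injective : ∀ t t' {s s'} → encode t ++ D ∷ s ≡ encode t' ++ D ∷ s' → t ≡ t' × s ≡ s'
encode-prefix-injective leaf       leaf         refl = refl , refl
encode-prefix-injective (node l r) (node l' r') {s} {s'} eq
  with refl , eq' ← encode-prefix-injective l l' (begin
         encode l ++ D ∷ encode r ++ D ∷ s      ≡⟨ sym (++-assoc (encode l) (D ∷ encode r) (D ∷ s)) ⟩
         (encode l ++ D ∷ encode r) ++ D ∷ s    ≡⟨ ∷-injectiveʳ eq ⟩
         (encode l' ++ D ∷ encode r') ++ D ∷ s' ≡⟨ ++-assoc (encode l') (D ∷ encode r') (D ∷ s') ⟩
         encode l' ++ D ∷ encode r' ++ D ∷ s'   ∎)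
  with refl , refl ← encode-prefix-injective r r' eq'
  = refl , refl

encode-injective : ∀ {t t'} → encode t ≡ encode t' → t ≡ t'
encode-injective {t} {t'} eq = proj₁ (encode-prefix-injective t t' (cong (_++ D ∷ []) eq))

-- The first-passage decomposition of a path descending from height h:
-- s = encode t₀ ++ D ∷ encode t₁ ++ D ∷ … ++ D ∷ encode tₕ.
data Forest : ℕ → List Step → Set where
  root : ∀ t → Forest 0 (encode t)
  _◂_  : ∀ {h s} t → Forest h s → Forest (suc h) (encode t ++ D ∷ s)

graft : ∀ {h s} t → Forest h s → Forest h (U ∷ encode t ++ D ∷ s)
graft t (root u)         = root (node t u)
graft t (_◂_ {s = s} u f) =
  subst (Forest _ ∘ (U ∷_)) (++-assoc (encode t) (D ∷ encode u) (D ∷ s)) (node t u ◂ f)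

forest : ∀ {h s} → DyckFrom h s → Forest h s
forest done     = root leaf
forest (down p) = leaf ◂ forest p
forest (up p) with t ◂ f ← forest p = graft t f

decode : ∀ {p} → Dyck p → ∃[ t ] encode t ≡ p
decode p with root t ← forest p = t , refl

-- weight m t is the sum of the peak heights of encode t drawn from height m - 1
-- (see sumpFrom-encode); a leaf as left child is a peak U D at height m.
mutual
  weight : ℕ → Tree → ℕ
  weight m leaf       = 0
  weight m (node l r) = leftWeight m l + weight m r

  leftWeight : ℕ → Tree → ℕ
  leftWeight m leaf         = m
  leftWeight m l@(node _ _) = weight (suc m) l

sumpFrom-encode : ∀ t h s → sumpFrom h (encode t ++ s) ≡ weight (suc h) t + sumpFrom h s
sumpFrom-encode leaf              h s = refl
sumpFrom-encode (node leaf r)     h s = begin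
  suc h + sumpFrom h (encode r ++ s)            ≡⟨ cong (_+_ (suc h)) (sumpFrom-encode r h s) ⟩
  suc h + (weight (suc h) r + sumpFrom h s)     ≡⟨ sym (+-assoc (suc h) _ _) ⟩
  suc h + weight (suc h) r + sumpFrom h s       ∎
sumpFrom-encode (node l@(node _ _) r) h s = begin
  sumpFrom (suc h) ((encode l ++ D ∷ encode r) ++ s)
    ≡⟨ cong (sumpFrom (suc h)) (++-assoc (encode l) (D ∷ encode r) s) ⟩
  sumpFrom (suc h) (encode l ++ D ∷ encode r ++ s)
    ≡⟨ sumpFrom-encode l (suc h) (D ∷ encode r ++ s) ⟩
  weight (suc (suc h)) l + sumpFrom h (encode r ++ s)
    ≡⟨ cong (_+_ (weight (suc (suc h)) l)) (sumpFrom-encode r h s) ⟩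
  weight (suc (suc h)) l + (weight (suc h) r + sumpFrom h s)
    ≡⟨ sym (+-assoc (weight (suc (suc h)) l) _ _) ⟩
  weight (suc (suc h)) l + weight (suc h) r + sumpFrom h s ∎

sump-encode : ∀ t → sump (encode t) ≡ weight 1 t
sump-encode t = begin
  sump (encode t)               ≡⟨ cong sump (sym (++-identityʳ (encode t))) ⟩
  sumpFrom 0 (encode t ++ [])   ≡⟨ sumpFrom-encode t 0 [] ⟩
  weight 1 t + 0                ≡⟨ +-identityʳ (weight 1 t) ⟩
  weight 1 t                    ∎

leftWeight-suc : ∀ m l → ∃[ i ] leftWeight (suc m) l ≡ suc i
leftWeight-suc m leaf       = m , refl
leftWeight-suc m (node a b) with i , eq ← leftWeight-suc (suc m) a =
  i + weight (suc (suc m)) b , cong (_+ weight (suc (suc m)) b) eq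

m≤leftWeight : ∀ m l → m ≤ leftWeight m l
m≤leftWeight m leaf       = ≤-refl
m≤leftWeight m (node a b) = ≤-trans (n≤1+n m) (≤-trans (m≤leftWeight (suc m) a) (m≤m+n _ _))

m≤weight-node : ∀ m l r → m ≤ weight m (node l r)
m≤weight-node m l r = ≤-trans (m≤leftWeight m l) (m≤m+n _ _)

sump≡0⇒≡[] : ∀ {p} → Dyck p → sump p ≡ 0 → p ≡ []
sump≡0⇒≡[] dy s with decode dy
... | leaf , refl       = refl
... | node l r , refl   =
  contradiction (≤-trans (m≤weight-node 1 l r) (≤-reflexive (trans (sym (sump-encode (node l r))) s))) λ ()

-- encode t never rises more than d above its base.
data HeightAtMost : ℕ → Tree → Set where
  leaf : ∀ {d} → HeightAtMost d leaf
  node : ∀ {d l r} → HeightAtMost d l → HeightAtMost (suc d) r → HeightAtMost (suc d) (node l r)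

mutual
  heightAtMost-weight : ∀ d m t → weight m t < d + m → HeightAtMost d t
  heightAtMost-weight d       m leaf       _ = leaf
  heightAtMost-weight zero    m (node l r) w<m = contradiction (≤-<-trans (m≤weight-node m l r) w<m) (<-irrefl refl)
  heightAtMost-weight (suc d) m (node l r) w<d+m =
    node (heightAtMost-leftWeight d m l (≤-<-trans (m≤m+n _ _) w<d+m))
         (heightAtMost-weight (suc d) m r (≤-<-trans (m≤n+m _ _) w<d+m))

  heightAtMost-leftWeight : ∀ d m l → leftWeight m l < suc d + m → HeightAtMost d l
  heightAtMost-leftWeight d m leaf         _ = leaf
  heightAtMost-leftWeight d m l@(node _ _) w<d+m =
    heightAtMost-weight d (suc m) l (subst (weight (suc m) l <_) (sym (+-suc d m)) w<d+m)

leafIf : Bool → List Tree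
leafIf true  = leaf ∷ []
leafIf false = []

∈-leafIf : ∀ {b t} → t ∈ leafIf b → T b × t ≡ leaf
∈-leafIf {true} (here refl) = _ , refl

leaf∈leafIf : ∀ {b} → T b → leaf ∈ leafIf b
leaf∈leafIf {true} _ = here refl

leafIf-unique : ∀ b → Unique (leafIf b)
leafIf-unique true  = [] ∷ []
leafIf-unique false = []

-- For 1 ≤ m and n ≤ f, trees f d m n lists the t with HeightAtMost d t and
-- weight m t ≡ n, and leftTrees f d m i those with leftWeight m t ≡ suc i instead;
-- the fuel f only makes the recursion structural.
mutual
  trees : (f d m n : ℕ) → List Tree
  trees f       d       m zero    = leaf ∷ []
  trees zero    d       m (suc n) = []
  trees (suc f) zero    m (suc n) = []
  trees (suc f) (suc d) m (suc n) = convolveWith node (leftTrees (suc f) d m) (trees f (suc d) m) n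

  leftTrees : (f d m i : ℕ) → List Tree
  leftTrees f d m i = leafIf (m ≡ᵇ suc i) ++ trees f d (suc m) (suc i)

weight-suc⇒leftWeight : ∀ m l {i} → weight (suc m) l ≡ suc i → leftWeight m l ≡ suc i
weight-suc⇒leftWeight m (node _ _) w = w

mutual
  trees-sound : ∀ f d m n {t} → t ∈ trees f d m n → HeightAtMost d t × weight m t ≡ n
  trees-sound f d m zero (here refl) = leaf , refl
  trees-sound (suc f) (suc d) m (suc n) t∈
    with i , j , i+j≡n , l , r , l∈ , r∈ , refl ← ∈-convolveWith⁻ node _ _ n t∈
    with hl , wl ← leftTrees-sound (suc f) d m i l∈
    with hr , wr ← trees-sound f (suc d) m j r∈
    = node hl hr , trans (cong₂ _+_ wl wr) (cong suc i+j≡n)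

  leftTrees-sound : ∀ f d m i {l} → l ∈ leftTrees f d m i → HeightAtMost d l × leftWeight m l ≡ suc i
  leftTrees-sound f d m i {l} l∈ with ∈-++⁻ (leafIf (m ≡ᵇ suc i)) l∈
  ... | inj₁ l∈leaf with m≡i , refl ← ∈-leafIf l∈leaf = leaf , ≡ᵇ⇒≡ m (suc i) m≡i
  ... | inj₂ l∈trees with hl , wl ← trees-sound f d (suc m) (suc i) l∈trees = hl , weight-suc⇒leftWeight m l wl

mutual
  trees-complete : ∀ {f d m t} → HeightAtMost d t → weight (suc m) t ≤ f →
    t ∈ trees f d (suc m) (weight (suc m) t)
  trees-complete leaf _ = here refl
  trees-complete {f} {suc d} {m} (node {l = l} {r} hl hr) w≤f with i , wl ← leftWeight-suc m l =
    subst (λ w → node l r ∈ trees f (suc d) (suc m) (w + wr)) (sym wl)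
          (node-complete hl hr wl (subst (λ w → w + wr ≤ f) wl w≤f))
    where
    wr : ℕ
    wr = weight (suc m) r

  node-complete : ∀ {f d m i l r} → HeightAtMost d l → HeightAtMost (suc d) r →
    leftWeight (suc m) l ≡ suc i → suc i + weight (suc m) r ≤ f →
    node l r ∈ trees f (suc d) (suc m) (suc i + weight (suc m) r)
  node-complete {suc f} {d} {m} {i} {r = r} hl hr wl (s≤s i+w≤f) =
    ∈-convolveWith⁺ node (leftTrees (suc f) d (suc m)) (trees f (suc d) (suc m)) i (weight (suc m) r)
      (leftTrees-complete hl wl (s≤s (≤-trans (m≤m+n i _) i+w≤f)))
      (trees-complete hr (≤-trans (m≤n+m _ i) i+w≤f))

  leftTrees-complete : ∀ {f d m i l} → HeightAtMost d l → leftWeight (suc m) l ≡ suc i → suc i ≤ f →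
    l ∈ leftTrees f d (suc m) i
  leftTrees-complete {m = m} leaf refl _ = ∈-++⁺ˡ (leaf∈leafIf (≡⇒≡ᵇ m m refl))
  leftTrees-complete {f} {d} {m} {i} {node a b} hl wl i<f =
    ∈-++⁺ʳ (leafIf (suc m ≡ᵇ suc i))
      (subst (λ n → node a b ∈ trees f d (suc (suc m)) n) wl
        (trees-complete hl (subst (_≤ f) (sym wl) i<f)))

mutual
  trees-unique : ∀ f d m n → Unique (trees f d m n)
  trees-unique f       d       m zero    = [] ∷ []
  trees-unique zero    d       m (suc n) = []
  trees-unique (suc f) zero    m (suc n) = []
  trees-unique (suc f) (suc d) m (suc n) =
    unique-convolveWith node node-injective (leftTrees (suc f) d m) (trees f (suc d) m) n
      (leftTrees-unique (suc f) d m) (trees-unique f (suc d) m)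
      (λ l∈ l∈' → suc-injective (trans (sym (proj₂ (leftTrees-sound (suc f) d m _ l∈)))
                                       (proj₂ (leftTrees-sound (suc f) d m _ l∈'))))

  leftTrees-unique : ∀ f d m i → Unique (leftTrees f d m i)
  leftTrees-unique f d m i =
    Unique.++⁺ (leafIf-unique (m ≡ᵇ suc i)) (trees-unique f d (suc m) (suc i)) leaf∉trees
    where
    leaf∉trees : ∀ {t} → t ∈ leafIf (m ≡ᵇ suc i) × t ∈ trees f d (suc m) (suc i) → ⊥
    leaf∉trees (t∈leaf , t∈trees) with _ , refl ← ∈-leafIf t∈leaf
      with () ← proj₂ (trees-sound f d (suc m) (suc i) t∈trees)

qpow≡length-leafIf : ∀ m n → qpow m n ≡ + length (leafIf (m ≡ᵇ n))
qpow≡length-leafIf m n with m ≡ᵇ n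
... | true  = refl
... | false = refl

0-x-y≡-[x+y] : ∀ x y → (+ 0 ℤ.- + x) ℤ.- + y ≡ - (+ (x + y))
0-x-y≡-[x+y] x y = begin
  (+ 0 ℤ.- + x) ℤ.- + y   ≡⟨ cong (ℤ._- + y) (ℤ.+-identityˡ (- (+ x))) ⟩
  - (+ x) ℤ.+ - (+ y)     ≡⟨ sym (ℤ.neg-distrib-+ (+ x) (+ y)) ⟩
  - (+ x ℤ.+ + y)         ≡⟨ cong -_ (sym (ℤ.pos-+ x y)) ⟩
  - (+ (x + y))           ∎

cf≡length-trees : ∀ f d m n → n ≤ f → cf d m n ≡ + length (trees f d m n)
cf≡length-trees f       zero    m zero    _ = refl
cf≡length-trees f       (suc d) m zero    _ = refl
cf≡length-trees (suc f) zero    m (suc n) _ = refl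
cf≡length-trees (suc f) (suc d) m (suc n) (s≤s n≤f) = begin
  inv a (suc n)
    ≡⟨ inv-suc leftCoefficient (λ {j} j≤n → cf≡length-trees f (suc d) m j (≤-trans j≤n n≤f)) ⟩
  + ((length ∘ leftTrees (suc f) d m) ⋆ (length ∘ trees f (suc d) m)) n
    ≡⟨ cong +_ (sym (length-convolveWith node (leftTrees (suc f) d m) (trees f (suc d) m) n)) ⟩
  + length (trees (suc f) (suc d) m (suc n)) ∎
  where
  a : Series
  a = (const (+ 2) ⊖ qpow m) ⊖ cf d (suc m)
  leftCoefficient : ∀ {i} → i ≤ n → a (suc i) ≡ - (+ length (leftTrees (suc f) d m i))
  leftCoefficient {i} i≤n = begin
    (+ 0 ℤ.- qpow m (suc i)) ℤ.- cf d (suc m) (suc i)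
      ≡⟨ cong₂ (λ x y → (+ 0 ℤ.- x) ℤ.- y) (qpow≡length-leafIf m (suc i))
                                           (cf≡length-trees (suc f) d (suc m) (suc i) (s≤s (≤-trans i≤n n≤f))) ⟩
    (+ 0 ℤ.- + length (leafIf (m ≡ᵇ suc i))) ℤ.- + length (trees (suc f) d (suc m) (suc i))
      ≡⟨ 0-x-y≡-[x+y] (length (leafIf (m ≡ᵇ suc i))) (length (trees (suc f) d (suc m) (suc i))) ⟩
    - (+ (length (leafIf (m ≡ᵇ suc i)) + length (trees (suc f) d (suc m) (suc i))))
      ≡⟨ cong (-_ ∘ +_) (sym (length-++ (leafIf (m ≡ᵇ suc i)))) ⟩
    - (+ length (leftTrees (suc f) d m i)) ∎

∈-trees⇔ : ∀ {f d m n t} → n ≤ f → n ≤ d → t ∈ trees f d (suc m) n ⇔ weight (suc m) t ≡ n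
∈-trees⇔ {f} {d} {m} {n} {t} n≤f n≤d = mk⇔ (proj₂ ∘ trees-sound f d (suc m) n) complete
  where
  complete : weight (suc m) t ≡ n → t ∈ trees f d (suc m) n
  complete refl = trees-complete (heightAtMost-weight d (suc m) t (≤-<-trans n≤d (m<m+n d (s≤s z≤n)))) n≤f

unique∧set⇒length≡ : ∀ {A : Set} {xs ys : List A} → Unique xs → Unique ys →
  (∀ {x} → x ∈ xs ⇔ x ∈ ys) → length xs ≡ length ys
unique∧set⇒length≡ uxs uys xs⇔ys = ↭-length (∼bag⇒↭ (unique∧set⇒bag uxs uys xs⇔ys))

length-trees-height-irrelevant : ∀ {f d d' m n} → n ≤ f → n ≤ d → n ≤ d' →
  length (trees f d (suc m) n) ≡ length (trees f d' (suc m) n)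
length-trees-height-irrelevant {f} {d} {d'} {m} {n} n≤f n≤d n≤d' =
  unique∧set⇒length≡ (trees-unique f d (suc m) n) (trees-unique f d' (suc m) n)
    (⇔.trans (∈-trees⇔ n≤f n≤d) (⇔.sym (∈-trees⇔ n≤f n≤d')))

∈-map-encode⇔ : ∀ {L k p} → (∀ {t} → t ∈ L ⇔ weight 1 t ≡ k) →
  p ∈ map encode L ⇔ (Dyck p × sump p ≡ k)
∈-map-encode⇔ {L} {k} {p} ∈L⇔ = mk⇔ to from
  where
  to : p ∈ map encode L → Dyck p × sump p ≡ k
  to p∈ with t , t∈ , refl ← ∈-map⁻ encode p∈ =
    encode-dyck t , trans (sump-encode t) (Equivalence.to ∈L⇔ t∈)
  from : Dyck p × sump p ≡ k → p ∈ map encode L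
  from (dy , s) with t , refl ← decode dy =
    ∈-map⁺ encode (Equivalence.from ∈L⇔ (trans (sym (sump-encode t)) s))

corollary3p4 : ∀ (k : ℕ) →
    ∃[ L ] (Unique L
            × (∀ (p : List Step) → (p ∈ L) ⇔ (Dyck p × p ≢ [] × sump p ≡ k))
            × ∃[ N₀ ] (∀ (N : ℕ) → N₀ ≤ N → Acf N k ≡ + length L))
corollary3p4 zero =
  [] , [] , (λ p → mk⇔ (λ ()) (λ (dy , p≢[] , s) → contradiction (sump≡0⇒≡[] dy s) p≢[])) ,
  0 , λ N _ → cong (ℤ._+_ (- (+ 1))) (cf≡length-trees 0 N 1 0 z≤n)
corollary3p4 (suc k) =
  map encode treesK , Unique.map⁺ encode-injective (trees-unique K K 1 K) , paths , K , count
  where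
  K : ℕ
  K = suc k
  treesK : List Tree
  treesK = trees K K 1 K
  paths : ∀ p → p ∈ map encode treesK ⇔ (Dyck p × p ≢ [] × sump p ≡ K)
  paths p = mk⇔ (λ p∈ → let dy , s = to p∈ in dy , nonempty s , s) (λ (dy , _ , s) → from (dy , s))
    where
    open Equivalence (∈-map-encode⇔ (∈-trees⇔ ≤-refl ≤-refl))
    nonempty : sump p ≡ K → p ≢ []
    nonempty s p≡[] = 0≢1+n (trans (cong sump (sym p≡[])) s)
  count : ∀ N → K ≤ N → Acf N K ≡ + length (map encode treesK)
  count N K≤N = begin
    + 0 ℤ.+ cf N 1 K              ≡⟨ ℤ.+-identityˡ (cf N 1 K) ⟩
    cf N 1 K                      ≡⟨ cf≡length-trees K N 1 K ≤-refl ⟩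
    + length (trees K N 1 K)      ≡⟨ cong +_ (length-trees-height-irrelevant ≤-refl K≤N ≤-refl) ⟩
    + length treesK               ≡⟨ cong +_ (sym (length-map encode treesK)) ⟩
    + length (map encode treesK)  ∎
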